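{- Let $G$ be a finite connected graph with decision tree $\Delta$, and let $S,S'$ be two spanning subgraphs of $G$. The following are equivalent: (i) $S$ and $S'$ have the same history; (ii) $S$ and $S'$ induce the same assignment of types to the edges of $G$; (iii) $S$ and $S'$ have the same set of edges of type $S_e$ and the same set of edges of type $S_i$; (iv) $S\ominus S'\subseteq\mathrm{Act}(S)$; (v) there exists $R\subseteq\mathrm{Act}(S)$ such that $S'=S\ominus R$.
   Context: Graphs may have loops and multiple edges; subgraphs are spanning and identified with their edge sets; $\ominus$ is symmetric difference. An isthmus is an edge whose deletion increases the number of components; a standard edge is neither a loop nor an isthmus. A decision tree is a perfect binary tree with nodes labelled by edges of $G$ such that along every root-to-leaf path the labels form a permutation of $E(G)$. For a subgraph $S$: set $H=G$, $n$ = root; for $k=1,\dots,m=|E(G)|$, let $e_k$ be the label of $n$; if $e_k$ standard in $H$ and $e_k\notin S$: type $t_k=S_e$, delete, go left; if $e_k$ a loop in $H$: type $L$, delete, go left; if $e_k$ standard in $H$ and $e_k\in S$: type $S_i$, contract, go right; if $e_k$ an isthmus of $H$: type $I$, contract, go right. The history of $S$ is the pair of sequences $(e_1,\dots,e_m)$, $(t_1,\dots,t_m)$. $\mathrm{Act}(S)$ is the set of edges of type $L$ or $I$. -}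

module Defs where

open import Data.Nat using (ℕ; zero; suc)
open import Data.Fin using (Fin; _≟_)
open import Data.Fin.Subset using (Subset; _∈_; _∉_; outside)
open import Data.Bool using (Bool; true; false; _xor_; if_then_else_)
open import Data.Vec using (Vec; zipWith; _[_]≔_; replicate)
open import Data.List using (List; []; _∷_)
import Data.List.Membership.Propositional as LMem
open import Data.Product using (Σ; ∃; ∃-syntax; _×_; _,_; proj₁; proj₂)
open import Data.Sum using (_⊎_)
open import Relation.Nullary using (¬_; does)
open import Relation.Binary.PropositionalEquality using (_≡_)

record Graph : Set where
  field
    n    : ℕ
    m    : ℕ
    ends : Fin m → Fin n × Fin n
open Graph public

-- A minor state H obtained from G by deletions and contractions:
-- current (relabelled) ends of every edge, and the set of edges still present.
-- Contraction merges the second end into the first (the vacated vertex is isolated).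
record Minor (n m : ℕ) : Set where
  constructor minor
  field
    mends : Fin m → Fin n × Fin n
    alive : Subset m
open Minor public

module _ {n m : ℕ} where

  data Walk (H : Minor n m) : Fin n → Fin n → Set where
    here  : ∀ {x} → Walk H x x
    step  : ∀ {x z y} (e : Fin m) → e ∈ alive H →
            (mends H e ≡ (x , z) ⊎ mends H e ≡ (z , x)) →
            Walk H z y → Walk H x y

  delete : Minor n m → Fin m → Minor n m
  delete H e = minor (mends H) (alive H [ e ]≔ outside)

  contract : Minor n m → Fin m → Minor n m
  contract H e = minor newEnds (alive H [ e ]≔ outside)
    where
      u = proj₁ (mends H e)
      v = proj₂ (mends H e)
      relabel : Fin n → Fin n
      relabel w = if does (w ≟ v) then u else w
      newEnds : Fin m → Fin n × Fin n
      newEnds f = relabel (proj₁ (mends H f)) , relabel (proj₂ (mends H f))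

  IsLoop : Minor n m → Fin m → Set
  IsLoop H e = e ∈ alive H × proj₁ (mends H e) ≡ proj₂ (mends H e)

  IsIsthmus : Minor n m → Fin m → Set
  IsIsthmus H e = e ∈ alive H × ∃[ x ] ∃[ y ] (Walk H x y × ¬ Walk (delete H e) x y)

  IsStandard : Minor n m → Fin m → Set
  IsStandard H e = e ∈ alive H × ¬ IsLoop H e × ¬ IsIsthmus H e

initial : (G : Graph) → Minor (n G) (m G)
initial G = minor (ends G) (replicate (m G) true)

Connected : Graph → Set
Connected G = ∀ x y → Walk (initial G) x y

data DTree (m : ℕ) : ℕ → Set where
  leaf : DTree m zero
  node : ∀ {k} → Fin m → DTree m k → DTree m k → DTree m (suc k)

-- labels along every root-to-leaf path are pairwise distinct; for a tree
-- of depth m over Fin m this says every path is a permutation of E(G)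
data PathsDistinct {m : ℕ} : List (Fin m) → ∀ {k} → DTree m k → Set where
  leaf : ∀ {used} → PathsDistinct used leaf
  node : ∀ {used k e} {l r : DTree m k} → ¬ (LMem._∈_ e used) →
         PathsDistinct (e ∷ used) l → PathsDistinct (e ∷ used) r →
         PathsDistinct used (node e l r)

IsDecisionTree : (G : Graph) → DTree (m G) (m G) → Set
IsDecisionTree G Δ = PathsDistinct [] Δ

data EdgeType : Set where
  Se L Si I : EdgeType

-- Run of the algorithm: history as the list of pairs (e_k , t_k)
data Run {n m : ℕ} (S : Subset m) : Minor n m → ∀ {k} → DTree m k → List (Fin m × EdgeType) → Set where
  leaf : ∀ {H} → Run S H leaf []
  stepSe : ∀ {H k e} {l r : DTree m k} {h} → IsStandard H e → e ∉ S →
           Run S (delete H e) l h → Run S H (node e l r) ((e , Se) ∷ h)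
  stepL  : ∀ {H k e} {l r : DTree m k} {h} → IsLoop H e →
           Run S (delete H e) l h → Run S H (node e l r) ((e , L) ∷ h)
  stepSi : ∀ {H k e} {l r : DTree m k} {h} → IsStandard H e → e ∈ S →
           Run S (contract H e) r h → Run S H (node e l r) ((e , Si) ∷ h)
  stepI  : ∀ {H k e} {l r : DTree m k} {h} → IsIsthmus H e →
           Run S (contract H e) r h → Run S H (node e l r) ((e , I) ∷ h)

HistoryOf : (G : Graph) → DTree (m G) (m G) → Subset (m G) → List (Fin (m G) × EdgeType) → Set
HistoryOf G Δ S h = Run S (initial G) Δ h

HasType : (G : Graph) → DTree (m G) (m G) → Subset (m G) → Fin (m G) → EdgeType → Set
HasType G Δ S e t = ∃[ h ] (HistoryOf G Δ S h × LMem._∈_ (e , t) h)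

Act : (G : Graph) → DTree (m G) (m G) → Subset (m G) → Fin (m G) → Set
Act G Δ S e = HasType G Δ S e L ⊎ HasType G Δ S e I

_⊖_ : ∀ {k} → Subset k → Subset k → Subset k
_⊖_ = zipWith _xor_

-- The run of the algorithm is a function of the decision tree and of the
-- membership in S of the edges it meets as standard edges: loops and
-- isthmuses are recognised from the current minor alone.  Walks in a finite
-- multigraph are decidable, so every S has a history; it is unique and
-- lists every edge exactly once.  Hence the history of S is also a history of
-- S' exactly when S' agrees with S on the edges of type S_e and S_i, that
-- is, when S ⊖ S' consists of edges of type L or I.
module Submission where

open import Defs
open import Data.Nat using (ℕ; suc; _≤_; _<_)
open import Data.Nat.Properties using (≤-trans; ≤-reflexive; ≤-pred; n≮0)
open import Data.Fin using (Fin; _≟_)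
open import Data.Fin.Properties using (any?)
open import Data.Fin.Subset using (Subset; _∈_; _∉_; _⊆_; _-_; ⁅_⁆; ∣_∣; inside; outside)
open import Data.Fin.Subset.Properties
  using (_∈?_; ∈⊤; ∣⊤∣≡n; drop-there; p─⊥≡p; p─q⊆p; x∈p⇒∣p-x∣<∣p∣)
open import Data.Bool using (true; false)
open import Data.Vec using ([]; _∷_; _[_]≔_; here; there)
open import Data.Vec.Properties using ([]=-injective; []≔-updates; []≔-minimal)
open import Data.List using (List; []; _∷_; allFin)
open import Data.List.Relation.Unary.Any using (here; there; tail)
open import Data.List.Membership.Propositional using () renaming (_∈_ to _∈ₗ_; _∉_ to _∉ₗ_)
open import Data.List.Membership.Propositional.Properties using (∈-allFin)
open import Data.Product using (Σ; ∃; ∃-syntax; _×_; _,_; -,_; proj₁; proj₂)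
open import Data.Sum using (_⊎_; inj₁; inj₂)
open import Data.Empty using (⊥-elim)
open import Function using (_∘_; const)
open import Function.Bundles using (_⇔_; mk⇔; module Equivalence)
open import Function.Properties.Equivalence using () renaming (trans to ⇔-trans)
open import Relation.Nullary using (¬_; Dec; yes; no)
open import Relation.Nullary.Decidable using (map′; _×-dec_; _⊎-dec_; ¬?)
open import Relation.Binary.PropositionalEquality using (_≡_; refl; sym; trans; cong; subst)

open Equivalence using (to; from)

⊖-cancelˡ : ∀ {k} (p q : Subset k) → p ⊖ (p ⊖ q) ≡ q
⊖-cancelˡ []          []          = refl
⊖-cancelˡ (true ∷ p)  (true ∷ q)  = cong (true ∷_) (⊖-cancelˡ p q)
⊖-cancelˡ (true ∷ p)  (false ∷ q) = cong (false ∷_) (⊖-cancelˡ p q)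
⊖-cancelˡ (false ∷ p) (b ∷ q)     = cong (b ∷_) (⊖-cancelˡ p q)

x∉p⊖q⇒x∈p⇔x∈q : ∀ {k} (p q : Subset k) {x} → x ∉ p ⊖ q → x ∈ p ⇔ x ∈ q
x∉p⊖q⇒x∈p⇔x∈q (true ∷ p)  (true ∷ q)  {Fin.zero} _   = mk⇔ (const here) (const here)
x∉p⊖q⇒x∈p⇔x∈q (false ∷ p) (false ∷ q) {Fin.zero} _   = mk⇔ (λ ()) (λ ())
x∉p⊖q⇒x∈p⇔x∈q (true ∷ p)  (false ∷ q) {Fin.zero} x∉ = ⊥-elim (x∉ here)
x∉p⊖q⇒x∈p⇔x∈q (false ∷ p) (true ∷ q)  {Fin.zero} x∉ = ⊥-elim (x∉ here)
x∉p⊖q⇒x∈p⇔x∈q (_ ∷ p)     (_ ∷ q)     {Fin.suc x} x∉ =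
  let x∈p⇔x∈q = x∉p⊖q⇒x∈p⇔x∈q p q (x∉ ∘ there)
  in mk⇔ (there ∘ to x∈p⇔x∈q ∘ drop-there) (there ∘ from x∈p⇔x∈q ∘ drop-there)

x∈p⇔x∈q⇒x∉p⊖q : ∀ {k} (p q : Subset k) {x} → x ∈ p ⇔ x ∈ q → x ∉ p ⊖ q
x∈p⇔x∈q⇒x∉p⊖q (true ∷ p)  (false ∷ q) x∈p⇔x∈q here with to x∈p⇔x∈q here
... | ()
x∈p⇔x∈q⇒x∉p⊖q (false ∷ p) (true ∷ q)  x∈p⇔x∈q here with from x∈p⇔x∈q here
... | ()
x∈p⇔x∈q⇒x∉p⊖q (_ ∷ p)     (_ ∷ q)     x∈p⇔x∈q (there x∈) =
  x∈p⇔x∈q⇒x∉p⊖q p q (mk⇔ (drop-there ∘ to x∈p⇔x∈q ∘ there) (drop-there ∘ from x∈p⇔x∈q ∘ there)) x∈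

[]≔outside≡- : ∀ {k} (p : Subset k) x → p [ x ]≔ outside ≡ p - x
[]≔outside≡- (_ ∷ p)       Fin.zero    = cong (outside ∷_) (sym (p─⊥≡p p))
[]≔outside≡- (inside ∷ p)  (Fin.suc x) = cong (inside ∷_) ([]≔outside≡- p x)
[]≔outside≡- (outside ∷ p) (Fin.suc x) = cong (outside ∷_) ([]≔outside≡- p x)

x∉p[x]≔outside : ∀ {k} (p : Subset k) x → x ∉ p [ x ]≔ outside
x∉p[x]≔outside p x x∈ with []=-injective x∈ ([]≔-updates p x)
... | ()

p[x]≔outside⊆p : ∀ {k} (p : Subset k) x → p [ x ]≔ outside ⊆ p
p[x]≔outside⊆p p x = p─q⊆p p ⁅ x ⁆ ∘ subst (_ ∈_) ([]≔outside≡- p x)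

x∈p⇒∣p[x]≔outside∣<∣p∣ : ∀ {k} {p : Subset k} {x} → x ∈ p → ∣ p [ x ]≔ outside ∣ < ∣ p ∣
x∈p⇒∣p[x]≔outside∣<∣p∣ {p = p} {x} x∈p =
  subst (λ q → ∣ q ∣ < ∣ p ∣) (sym ([]≔outside≡- p x)) (x∈p⇒∣p-x∣<∣p∣ x∈p)

module _ {n m : ℕ} where

  Walk-mono : ∀ {ends : Fin m → Fin n × Fin n} {a b : Subset m} → a ⊆ b →
              ∀ {x y} → Walk (minor ends a) x y → Walk (minor ends b) x y
  Walk-mono a⊆b here            = here
  Walk-mono a⊆b (step f f∈ p w) = step f (a⊆b f∈) p (Walk-mono a⊆b w)

  _◅◅_ : ∀ {H : Minor n m} {x y z} → Walk H x y → Walk H y z → Walk H x z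
  here            ◅◅ w′ = w′
  (step f f∈ p w) ◅◅ w′ = step f f∈ p (w ◅◅ w′)

  Walk-delete : ∀ {H : Minor n m} {e x y} → Walk (delete H e) x y → Walk H x y
  Walk-delete {H} {e} = Walk-mono (p[x]≔outside⊆p (alive H) e)

  module WalkSplit (H : Minor n m) (e : Fin m) where

    u v : Fin n
    u = proj₁ (mends H e)
    v = proj₂ (mends H e)

    WalkThrough : Fin n → Fin n → Set
    WalkThrough x y = Walk (delete H e) x y
                    ⊎ (Walk (delete H e) x u × Walk (delete H e) v y)
                    ⊎ (Walk (delete H e) x v × Walk (delete H e) u y)

    -- A walk using e several times is shortcut from its first to its last use of e.
    walk-split : ∀ {x y} → Walk H x y → WalkThrough x y
    walk-split here = inj₁ here
    walk-split (step f f∈ p w) with f ≟ e | walk-split w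
    ... | yes refl | rest = cross p rest
      where
      cross : ∀ {x z y} → (mends H e ≡ (x , z) ⊎ mends H e ≡ (z , x)) → WalkThrough z y → WalkThrough x y
      cross (inj₁ refl) (inj₁ w′)             = inj₂ (inj₁ (here , w′))
      cross (inj₁ refl) (inj₂ (inj₁ (_ , w′))) = inj₂ (inj₁ (here , w′))
      cross (inj₁ refl) (inj₂ (inj₂ (_ , w′))) = inj₁ w′
      cross (inj₂ refl) (inj₁ w′)             = inj₂ (inj₂ (here , w′))
      cross (inj₂ refl) (inj₂ (inj₁ (_ , w′))) = inj₁ w′
      cross (inj₂ refl) (inj₂ (inj₂ (_ , w′))) = inj₂ (inj₂ (here , w′))
    ... | no f≢e | inj₁ w′              = inj₁ (step f ([]≔-minimal _ f e f≢e f∈) p w′)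
    ... | no f≢e | inj₂ (inj₁ (w₁ , w₂)) = inj₂ (inj₁ (step f ([]≔-minimal _ f e f≢e f∈) p w₁ , w₂))
    ... | no f≢e | inj₂ (inj₂ (w₁ , w₂)) = inj₂ (inj₂ (step f ([]≔-minimal _ f e f≢e f∈) p w₁ , w₂))

    walk-join : e ∈ alive H → ∀ {x y} → WalkThrough x y → Walk H x y
    walk-join e∈ (inj₁ w)                = Walk-delete w
    walk-join e∈ (inj₂ (inj₁ (w₁ , w₂))) = Walk-delete w₁ ◅◅ step e e∈ (inj₁ refl) (Walk-delete w₂)
    walk-join e∈ (inj₂ (inj₂ (w₁ , w₂))) = Walk-delete w₁ ◅◅ step e e∈ (inj₂ refl) (Walk-delete w₂)

  open WalkSplit using (walk-split; walk-join)

  loop⇒¬isthmus : ∀ {H : Minor n m} {e} → IsLoop H e → ¬ IsIsthmus H e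
  loop⇒¬isthmus {H} {e} (_ , u≡v) (_ , x , y , w , ¬w′) with walk-split H e w
  ... | inj₁ w′              = ¬w′ w′
  ... | inj₂ (inj₁ (w₁ , w₂)) = ¬w′ (w₁ ◅◅ subst (λ z → Walk (delete H e) z y) (sym u≡v) w₂)
  ... | inj₂ (inj₂ (w₁ , w₂)) = ¬w′ (w₁ ◅◅ subst (λ z → Walk (delete H e) z y) u≡v w₂)

  -- The list es only serves as a termination measure.
  walk? : ∀ (H : Minor n m) (es : List (Fin m)) → (∀ {f} → f ∈ alive H → f ∈ₗ es) →
          ∀ x y → Dec (Walk H x y)
  walk? H [] alive⊆[] x y = map′ (λ { refl → here }) no-edges (x ≟ y)
    where
    no-edges : ∀ {x y} → Walk H x y → x ≡ y
    no-edges here               = refl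
    no-edges (step _ f∈ _ _) with alive⊆[] f∈
    ... | ()
  walk? H (e ∷ es) alive⊆ x y with e ∈? alive H
  ... | no e∉ = walk? H es (λ {f} f∈ → tail (λ { refl → e∉ f∈ }) (alive⊆ f∈)) x y
  ... | yes e∈ = map′ (walk-join H e e∈) (walk-split H e)
                   (rec x y ⊎-dec (rec x u ×-dec rec v y) ⊎-dec (rec x v ×-dec rec u y))
    where
    open WalkSplit H e using (u; v)
    rec = walk? (delete H e) es λ {f} f∈ →
      tail (λ { refl → x∉p[x]≔outside (alive H) e f∈ }) (alive⊆ (p[x]≔outside⊆p (alive H) e f∈))

  isthmus? : ∀ (H : Minor n m) e → Dec (IsIsthmus H e)
  isthmus? H e = e ∈? alive H ×-dec any? λ x → any? λ y →
    walk?′ H x y ×-dec ¬? (walk?′ (delete H e) x y)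
    where
    walk?′ : ∀ (H : Minor n m) x y → Dec (Walk H x y)
    walk?′ H = walk? H (allFin m) (λ {f} _ → ∈-allFin f)

  covers-step : ∀ {a : Subset m} {f k} {T : EdgeType} {h : List (Fin m × EdgeType)} → f ∈ a →
                (∣ a [ f ]≔ outside ∣ ≤ k → ∀ {e} → e ∈ a [ f ]≔ outside → Σ EdgeType λ T′ → (e , T′) ∈ₗ h) →
                ∣ a ∣ ≤ suc k → ∀ {e} → e ∈ a → Σ EdgeType λ T′ → (e , T′) ∈ₗ (f , T) ∷ h
  covers-step {a} {f} f∈ covers bound {e} e∈ with e ≟ f
  ... | yes refl = -, here refl
  ... | no e≢f   = let T′ , p = covers (≤-pred (≤-trans (x∈p⇒∣p[x]≔outside∣<∣p∣ f∈) bound))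
                                       ([]≔-minimal a e f e≢f e∈)
                   in T′ , there p

  type-unique-step : ∀ {a : Subset m} {f} {T : EdgeType} {h : List (Fin m × EdgeType)} →
                     (∀ {e T′} → (e , T′) ∈ₗ h → e ∈ a [ f ]≔ outside) →
                     (∀ {e T₁ T₂} → (e , T₁) ∈ₗ h → (e , T₂) ∈ₗ h → T₁ ≡ T₂) →
                     ∀ {e T₁ T₂} → (e , T₁) ∈ₗ (f , T) ∷ h → (e , T₂) ∈ₗ (f , T) ∷ h → T₁ ≡ T₂
  type-unique-step         alive′ unique (here refl) (here refl) = refl
  type-unique-step {a} {f} alive′ unique (here refl) (there q)   = ⊥-elim (x∉p[x]≔outside a f (alive′ q))
  type-unique-step {a} {f} alive′ unique (there p)   (here refl) = ⊥-elim (x∉p[x]≔outside a f (alive′ p))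
  type-unique-step         alive′ unique (there p)   (there q)   = unique p q

  module _ {S : Subset m} where

    Run-exists : ∀ (H : Minor n m) {k} (t : DTree m k) {used} → PathsDistinct used t →
                 (∀ f → f ∉ₗ used → f ∈ alive H) → ∃ (Run S H t)
    Run-exists H leaf _ _ = -, leaf
    Run-exists H (node e l r) {used} (node e∉used l-distinct r-distinct) unused⊆alive =
      first-step (Run-exists (delete H e) l l-distinct unused⊆alive′)
                 (Run-exists (contract H e) r r-distinct unused⊆alive′)
      where
      e∈H = unused⊆alive e e∉used

      unused⊆alive′ : ∀ f → f ∉ₗ e ∷ used → f ∈ alive H [ e ]≔ outside
      unused⊆alive′ f f∉ = []≔-minimal (alive H) f e (f∉ ∘ here) (unused⊆alive f (f∉ ∘ there))

      first-step : ∃ (Run S (delete H e) l) → ∃ (Run S (contract H e) r) → ∃ (Run S H (node e l r))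
      first-step (_ , del) (_ , con) with proj₁ (mends H e) ≟ proj₂ (mends H e) | isthmus? H e | e ∈? S
      ... | yes loop | _        | _       = -, stepL (e∈H , loop) del
      ... | no ¬loop | yes isth | _       = -, stepI isth con
      ... | no ¬loop | no ¬isth | yes e∈S = -, stepSi (e∈H , ¬loop ∘ proj₂ , ¬isth) e∈S con
      ... | no ¬loop | no ¬isth | no e∉S  = -, stepSe (e∈H , ¬loop ∘ proj₂ , ¬isth) e∉S del

    Run-deterministic : ∀ {H : Minor n m} {k} {t : DTree m k} {h h′} → Run S H t h → Run S H t h′ → h ≡ h′
    Run-deterministic leaf leaf = refl
    Run-deterministic (stepSe _ _ r) (stepSe _ _ r′) = cong (_ ∷_) (Run-deterministic r r′)
    Run-deterministic (stepL _ r)    (stepL _ r′)    = cong (_ ∷_) (Run-deterministic r r′)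
    Run-deterministic (stepSi _ _ r) (stepSi _ _ r′) = cong (_ ∷_) (Run-deterministic r r′)
    Run-deterministic (stepI _ r)    (stepI _ r′)    = cong (_ ∷_) (Run-deterministic r r′)
    Run-deterministic (stepSe _ e∉ _) (stepSi _ e∈ _) = ⊥-elim (e∉ e∈)
    Run-deterministic (stepSi _ e∈ _) (stepSe _ e∉ _) = ⊥-elim (e∉ e∈)
    Run-deterministic (stepSe st _ _) (stepL lp _)    = ⊥-elim (proj₁ (proj₂ st) lp)
    Run-deterministic (stepSi st _ _) (stepL lp _)    = ⊥-elim (proj₁ (proj₂ st) lp)
    Run-deterministic (stepL lp _)    (stepSe st _ _) = ⊥-elim (proj₁ (proj₂ st) lp)
    Run-deterministic (stepL lp _)    (stepSi st _ _) = ⊥-elim (proj₁ (proj₂ st) lp)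
    Run-deterministic (stepSe st _ _) (stepI is _)    = ⊥-elim (proj₂ (proj₂ st) is)
    Run-deterministic (stepSi st _ _) (stepI is _)    = ⊥-elim (proj₂ (proj₂ st) is)
    Run-deterministic (stepI is _)    (stepSe st _ _) = ⊥-elim (proj₂ (proj₂ st) is)
    Run-deterministic (stepI is _)    (stepSi st _ _) = ⊥-elim (proj₂ (proj₂ st) is)
    Run-deterministic (stepL lp _)    (stepI is _)    = ⊥-elim (loop⇒¬isthmus lp is)
    Run-deterministic (stepI is _)    (stepL lp _)    = ⊥-elim (loop⇒¬isthmus lp is)

    Run-covers : ∀ {H : Minor n m} {k} {t : DTree m k} {h} → Run S H t h → ∣ alive H ∣ ≤ k →
                 ∀ {e} → e ∈ alive H → Σ EdgeType λ T → (e , T) ∈ₗ h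
    Run-covers leaf bound e∈ = ⊥-elim (n≮0 (≤-trans (x∈p⇒∣p[x]≔outside∣<∣p∣ e∈) bound))
    Run-covers (stepSe st _ r) = covers-step (proj₁ st) (Run-covers r)
    Run-covers (stepL lp r)    = covers-step (proj₁ lp) (Run-covers r)
    Run-covers (stepSi st _ r) = covers-step (proj₁ st) (Run-covers r)
    Run-covers (stepI is r)    = covers-step (proj₁ is) (Run-covers r)

    Run-alive : ∀ {H : Minor n m} {k} {t : DTree m k} {h} → Run S H t h →
                ∀ {e T} → (e , T) ∈ₗ h → e ∈ alive H
    Run-alive (stepSe st _ _) (here refl) = proj₁ st
    Run-alive (stepL lp _)    (here refl) = proj₁ lp
    Run-alive (stepSi st _ _) (here refl) = proj₁ st
    Run-alive (stepI is _)    (here refl) = proj₁ is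
    Run-alive {H} (stepSe {e = f} _ _ r) (there p) = p[x]≔outside⊆p (alive H) f (Run-alive r p)
    Run-alive {H} (stepL {e = f} _ r)    (there p) = p[x]≔outside⊆p (alive H) f (Run-alive r p)
    Run-alive {H} (stepSi {e = f} _ _ r) (there p) = p[x]≔outside⊆p (alive H) f (Run-alive r p)
    Run-alive {H} (stepI {e = f} _ r)    (there p) = p[x]≔outside⊆p (alive H) f (Run-alive r p)

    Run-type-unique : ∀ {H : Minor n m} {k} {t : DTree m k} {h} → Run S H t h →
                      ∀ {e T T′} → (e , T) ∈ₗ h → (e , T′) ∈ₗ h → T ≡ T′
    Run-type-unique (stepSe _ _ r) = type-unique-step (Run-alive r) (Run-type-unique r)
    Run-type-unique (stepL _ r)    = type-unique-step (Run-alive r) (Run-type-unique r)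
    Run-type-unique (stepSi _ _ r) = type-unique-step (Run-alive r) (Run-type-unique r)
    Run-type-unique (stepI _ r)    = type-unique-step (Run-alive r) (Run-type-unique r)

    Run-Se⇒∉ : ∀ {H : Minor n m} {k} {t : DTree m k} {h} → Run S H t h → ∀ {e} → (e , Se) ∈ₗ h → e ∉ S
    Run-Se⇒∉ (stepSe _ e∉ _) (here refl) = e∉
    Run-Se⇒∉ (stepSe _ _ r)  (there p)   = Run-Se⇒∉ r p
    Run-Se⇒∉ (stepL _ r)     (there p)   = Run-Se⇒∉ r p
    Run-Se⇒∉ (stepSi _ _ r)  (there p)   = Run-Se⇒∉ r p
    Run-Se⇒∉ (stepI _ r)     (there p)   = Run-Se⇒∉ r p

    Run-Si⇒∈ : ∀ {H : Minor n m} {k} {t : DTree m k} {h} → Run S H t h → ∀ {e} → (e , Si) ∈ₗ h → e ∈ S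
    Run-Si⇒∈ (stepSi _ e∈ _) (here refl) = e∈
    Run-Si⇒∈ (stepSe _ _ r)  (there p)   = Run-Si⇒∈ r p
    Run-Si⇒∈ (stepL _ r)     (there p)   = Run-Si⇒∈ r p
    Run-Si⇒∈ (stepSi _ _ r)  (there p)   = Run-Si⇒∈ r p
    Run-Si⇒∈ (stepI _ r)     (there p)   = Run-Si⇒∈ r p

  Run-transfer : ∀ {S S′ : Subset m} {H : Minor n m} {k} {t : DTree m k} {h} → Run S H t h →
                 (∀ {e} → (e , Se) ∈ₗ h → e ∉ S′) → (∀ {e} → (e , Si) ∈ₗ h → e ∈ S′) → Run S′ H t h
  Run-transfer leaf           _    _    = leaf
  Run-transfer (stepSe st _ r) Se∉ Si∈ = stepSe st (Se∉ (here refl)) (Run-transfer r (Se∉ ∘ there) (Si∈ ∘ there))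
  Run-transfer (stepL lp r)    Se∉ Si∈ = stepL lp (Run-transfer r (Se∉ ∘ there) (Si∈ ∘ there))
  Run-transfer (stepSi st _ r) Se∉ Si∈ = stepSi st (Si∈ (here refl)) (Run-transfer r (Se∉ ∘ there) (Si∈ ∘ there))
  Run-transfer (stepI is r)    Se∉ Si∈ = stepI is (Run-transfer r (Se∉ ∘ there) (Si∈ ∘ there))

data Active : EdgeType → Set where
  loop    : Active L
  isthmus : Active I

module _ (G : Graph) (Δ : DTree (m G) (m G)) where

  history-exists : IsDecisionTree G Δ → ∀ S → ∃ (HistoryOf G Δ S)
  history-exists isDT S = Run-exists (initial G) Δ isDT (λ _ _ → ∈⊤)

  history-covers : ∀ {S h} → HistoryOf G Δ S h → ∀ e → Σ EdgeType λ T → (e , T) ∈ₗ h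
  history-covers run e = Run-covers run (≤-reflexive (∣⊤∣≡n (m G))) ∈⊤

  HasType-Se⇒∉ : ∀ {S e} → HasType G Δ S e Se → e ∉ S
  HasType-Se⇒∉ (_ , run , p) = Run-Se⇒∉ run p

  HasType-Si⇒∈ : ∀ {S e} → HasType G Δ S e Si → e ∈ S
  HasType-Si⇒∈ (_ , run , p) = Run-Si⇒∈ run p

  Act⇒Active : ∀ {S h e T} → HistoryOf G Δ S h → Act G Δ S e → (e , T) ∈ₗ h → Active T
  Act⇒Active run (inj₁ (_ , run′ , p′)) p with Run-deterministic run run′
  ... | refl = subst Active (Run-type-unique run p′ p) loop
  Act⇒Active run (inj₂ (_ , run′ , p′)) p with Run-deterministic run run′
  ... | refl = subst Active (Run-type-unique run p′ p) isthmus

  module Conditions (S S′ : Subset (m G)) where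

    SameHistory SameTypes SameStandardTypes ActiveDifference ActiveShift : Set
    SameHistory       = ∀ h → (HistoryOf G Δ S h ⇔ HistoryOf G Δ S′ h)
    SameTypes         = ∀ e t → (HasType G Δ S e t ⇔ HasType G Δ S′ e t)
    SameStandardTypes = ∀ e → ((HasType G Δ S e Se ⇔ HasType G Δ S′ e Se) × (HasType G Δ S e Si ⇔ HasType G Δ S′ e Si))
    ActiveDifference  = ∀ e → e ∈ (S ⊖ S′) → Act G Δ S e
    ActiveShift       = ∃[ R ] ((∀ e → e ∈ R → Act G Δ S e) × S′ ≡ S ⊖ R)

    sameHistory⇒sameTypes : SameHistory → SameTypes
    sameHistory⇒sameTypes same e t = mk⇔
      (λ (h , run , p) → h , to (same h) run , p)
      (λ (h , run , p) → h , from (same h) run , p)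

    sameTypes⇒sameStandardTypes : SameTypes → SameStandardTypes
    sameTypes⇒sameStandardTypes same e = same e Se , same e Si

    sharedHistory⇒sameHistory : ∀ {h} → HistoryOf G Δ S h → HistoryOf G Δ S′ h → SameHistory
    sharedHistory⇒sameHistory run run′ h = mk⇔
      (λ r → subst (HistoryOf G Δ S′) (Run-deterministic run r) run′)
      (λ r′ → subst (HistoryOf G Δ S) (Run-deterministic run′ r′) run)

    sameStandardTypes⇒sameHistory : IsDecisionTree G Δ → SameStandardTypes → SameHistory
    sameStandardTypes⇒sameHistory isDT same with history-exists isDT S
    ... | h , run = sharedHistory⇒sameHistory run (Run-transfer run
      (λ {e} p → HasType-Se⇒∉ (to (proj₁ (same e)) (h , run , p)))
      (λ {e} p → HasType-Si⇒∈ (to (proj₂ (same e)) (h , run , p))))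

    sameHistory⇒activeDifference : IsDecisionTree G Δ → SameHistory → ActiveDifference
    sameHistory⇒activeDifference isDT same e e∈S⊖S′ with history-exists isDT S
    ... | h , run with history-covers run e
    ... | L  , p = inj₁ (h , run , p)
    ... | I  , p = inj₂ (h , run , p)
    ... | Se , p = ⊥-elim (x∈p⇔x∈q⇒x∉p⊖q S S′ (mk⇔ (⊥-elim ∘ Run-Se⇒∉ run p) (⊥-elim ∘ Run-Se⇒∉ run′ p)) e∈S⊖S′)
      where run′ = to (same h) run
    ... | Si , p = ⊥-elim (x∈p⇔x∈q⇒x∉p⊖q S S′ (mk⇔ (const (Run-Si⇒∈ run′ p)) (const (Run-Si⇒∈ run p))) e∈S⊖S′)
      where run′ = to (same h) run

    activeDifference⇒sameHistory : IsDecisionTree G Δ → ActiveDifference → SameHistory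
    activeDifference⇒sameHistory isDT active with history-exists isDT S
    ... | h , run = sharedHistory⇒sameHistory run (Run-transfer run
      (λ p → Run-Se⇒∉ run p ∘ from (agree p λ ()))
      (λ p → to (agree p λ ()) (Run-Si⇒∈ run p)))
      where
      agree : ∀ {e T} → (e , T) ∈ₗ h → ¬ Active T → e ∈ S ⇔ e ∈ S′
      agree {e} p inactive = x∉p⊖q⇒x∈p⇔x∈q S S′ (inactive ∘ λ e∈ → Act⇒Active run (active e e∈) p)

    activeDifference⇔activeShift : ActiveDifference ⇔ ActiveShift
    activeDifference⇔activeShift = mk⇔
      (λ active → S ⊖ S′ , active , sym (⊖-cancelˡ S S′))
      (λ (R , R-active , S′≡S⊖R) e e∈ →
        R-active e (subst (e ∈_) (trans (cong (S ⊖_) S′≡S⊖R) (⊖-cancelˡ S R)) e∈))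

proposition13p2p1 : (G : Graph) → Connected G → (Δ : DTree (m G) (m G)) → IsDecisionTree G Δ →
  (S S' : Subset (m G)) →
  let
    i = ∀ h → (HistoryOf G Δ S h ⇔ HistoryOf G Δ S' h)
    ii = ∀ e t → (HasType G Δ S e t ⇔ HasType G Δ S' e t)
    iii = ∀ e → ((HasType G Δ S e Se ⇔ HasType G Δ S' e Se) × (HasType G Δ S e Si ⇔ HasType G Δ S' e Si))
    iv = ∀ e → e ∈ (S ⊖ S') → Act G Δ S e
    v = ∃[ R ] ((∀ e → e ∈ R → Act G Δ S e) × S' ≡ S ⊖ R)
  in (i ⇔ ii) × (i ⇔ iii) × (i ⇔ iv) × (i ⇔ v)
proposition13p2p1 G _ Δ isDT S S′ = i⇔ii , i⇔iii , i⇔iv , ⇔-trans i⇔iv activeDifference⇔activeShift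
  where
  open Conditions G Δ S S′
  i⇔iii = mk⇔ (sameTypes⇒sameStandardTypes ∘ sameHistory⇒sameTypes) (sameStandardTypes⇒sameHistory isDT)
  i⇔ii  = mk⇔ sameHistory⇒sameTypes (sameStandardTypes⇒sameHistory isDT ∘ sameTypes⇒sameStandardTypes)
  i⇔iv  = mk⇔ (sameHistory⇒activeDifference isDT) (activeDifference⇒sameHistory isDT)
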